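{- Let $G$ be a digraph and let $u,v,x,y$ be distinct vertices of $G$ such that $u\leftrightarrow_{\mathrm{vr}} x$, $v\leftrightarrow_{\mathrm{vr}} x$, $u\leftrightarrow_{\mathrm{vr}} y$ and $v\leftrightarrow_{\mathrm{vr}} y$. Then $x\leftrightarrow_{\mathrm{vr}} y$ and $u\leftrightarrow_{\mathrm{vr}} v$.
   Context: Two distinct vertices $v,w$ of a digraph $G$ are vertex-resilient, written $v\leftrightarrow_{\mathrm{vr}} w$, if for every vertex $z\notin\{v,w\}$, the vertices $v$ and $w$ lie in the same strongly connected component of $G\setminus z$. -}

module Defs where

open import Data.Nat using (ℕ)
open import Data.Fin using (Fin)
open import Data.Product using (_×_)
open import Relation.Nullary using (¬_)
open import Relation.Binary.PropositionalEquality using (_≡_; _≢_)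
open import Relation.Binary.Construct.Closure.ReflexiveTransitive using (Star)

record Digraph : Set₁ where
  field
    n : ℕ
    E : Fin n → Fin n → Set

open Digraph public

Vertex : Digraph → Set
Vertex G = Fin (n G)

ArcWithout : (G : Digraph) → Vertex G → Vertex G → Vertex G → Set
ArcWithout G z a b = (a ≢ z) × (b ≢ z) × E G a b

-- Reachability in G ∖ z (for endpoints different from z): a directed walk of
-- arcs of G ∖ z (the empty walk gives reachability of a vertex from itself).
ReachWithout : (G : Digraph) → Vertex G → Vertex G → Vertex G → Set
ReachWithout G z = Star (ArcWithout G z)

SameSCCWithout : (G : Digraph) → Vertex G → Vertex G → Vertex G → Set
SameSCCWithout G z a b = ReachWithout G z a b × ReachWithout G z b a

VR : (G : Digraph) → Vertex G → Vertex G → Set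
VR G v w = (v ≢ w) × ((z : Vertex G) → z ≢ v → z ≢ w → SameSCCWithout G z v w)

-- Idea: fix a deleted vertex z ∉ {a, b}.  Since the witnesses m₁ ≠ m₂,
-- z differs from at least one of them, say m.  Then m is in the same strongly
-- connected component of G ∖ z as a and as b, so a and b share a component.
module Submission where

open import Defs
open import Data.Product using (_×_; _,_)
open import Data.Fin using (_≟_)
open import Relation.Nullary using (yes; no)
open import Relation.Binary.PropositionalEquality using (_≢_; refl; sym)
open import Relation.Binary.Construct.Closure.ReflexiveTransitive using (_◅◅_)

SameSCC-sym : ∀ {G z a b} → SameSCCWithout G z a b → SameSCCWithout G z b a
SameSCC-sym (a↝b , b↝a) = b↝a , a↝b

SameSCC-trans : ∀ {G z a b c} →
  SameSCCWithout G z a b → SameSCCWithout G z b c → SameSCCWithout G z a c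
SameSCC-trans (a↝b , b↝a) (b↝c , c↝b) = (a↝b ◅◅ b↝c) , (c↝b ◅◅ b↝a)

VR-sym : ∀ {G a b} → VR G a b → VR G b a
VR-sym (a≢b , resilient) =
  (λ b≡a → a≢b (sym b≡a)) , λ z z≢b z≢a → SameSCC-sym (resilient z z≢a z≢b)

common-witnesses⇒VR : (G : Digraph) (a b m₁ m₂ : Vertex G) → a ≢ b → m₁ ≢ m₂ →
  VR G m₁ a → VR G m₁ b → VR G m₂ a → VR G m₂ b → VR G a b
common-witnesses⇒VR G a b m₁ m₂ a≢b m₁≢m₂ (_ , m₁a) (_ , m₁b) (_ , m₂a) (_ , m₂b) =
  a≢b , resilient
  where
  resilient : (z : Vertex G) → z ≢ a → z ≢ b → SameSCCWithout G z a b
  resilient z z≢a z≢b with z ≟ m₁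
  ... | no z≢m₁ = SameSCC-trans (SameSCC-sym (m₁a z z≢m₁ z≢a)) (m₁b z z≢m₁ z≢b)
  ... | yes refl = SameSCC-trans (SameSCC-sym (m₂a z m₁≢m₂ z≢a)) (m₂b z m₁≢m₂ z≢b)

lemma1 : (G : Digraph) (u v x y : Vertex G) →
    u ≢ v → u ≢ x → u ≢ y → v ≢ x → v ≢ y → x ≢ y →
    VR G u x → VR G v x → VR G u y → VR G v y →
    VR G x y × VR G u v
lemma1 G u v x y u≢v _ _ _ _ x≢y ux vx uy vy =
  common-witnesses⇒VR G x y u v x≢y u≢v ux uy vx vy ,
  common-witnesses⇒VR G u v x y u≢v x≢y (VR-sym ux) (VR-sym vx) (VR-sym uy) (VR-sym vy)
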